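{- Let $G$ be a connected graph, and let $\mathcal{P}\subseteq\mathcal{L}(G)$ with $|\mathcal{P}|=3$. Then $|X_{\mathcal{P}}(P)|\geq t_{\mathcal{P}}(P)\,(f(G,\mathcal{P})-1)$ for each $P\in\mathcal{P}$.
   Context: All graphs are finite and simple. For a connected graph $G$, $l(G)$ is the length (number of edges) of a longest path in $G$ and $\mathcal{L}(G)$ is the set of paths in $G$ with exactly $l(G)+1$ vertices. For $U\subseteq V(G)$, $d_G(x,U)=\min_{y\in U} d_G(x,y)$, and for $\mathcal{P}\subseteq\mathcal{L}(G)$, $f(G,\mathcal{P})=\min\{\sum_{P\in\mathcal{P}} d_G(v,V(P))\mid v\in V(G)\}$. For $X,Y\subseteq V(G)$, a path $Q$ with end-vertices $x,y$ (possibly $x=y$, in which case $Q$ is a single vertex) is an $X$-$Y$ path if $V(Q)\cap X=\{x\}$ and $V(Q)\cap Y=\{y\}$. For a set $\mathcal{P}$ of paths and $P\in\mathcal{P}$, $X_{\mathcal{P}}(P)=V(P)\setminus\bigcup_{P'\in\mathcal{P}\setminus\{P\}}V(P')$. For a set $\mathcal{P}$ of three paths and $P\in\mathcal{P}$ with $\mathcal{P}\setminus\{P\}=\{P_1,P_2\}$, $t_{\mathcal{P}}(P)$ is the number of $V(P_1)$-$V(P_2)$ paths that are subpaths of $P$. -}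

module Defs where

open import Data.Nat using (ℕ; zero; suc; _+_; _≤_)
open import Data.Fin using (Fin)
open import Data.Fin.Properties using (_≟_)
open import Data.List using (List; []; _∷_; length; reverse; map; _++_; inits; filter)
open import Data.List.Relation.Unary.All using (All; all?)
open import Data.List.Relation.Unary.Unique.Propositional using (Unique)
open import Data.List.Membership.Propositional using (_∈_)
open import Data.Product using (Σ; _×_; _,_; ∃)
open import Data.Sum using (_⊎_)
open import Data.Empty using (⊥)
open import Relation.Nullary using (¬_; Dec; no; ¬?)
open import Relation.Nullary.Decidable using (_×-dec_; _⊎-dec_; _→-dec_)
open import Relation.Binary.PropositionalEquality using (_≡_)
import Data.List.Membership.DecPropositional as DecMem

record Graph : Set₁ where
  field
    n     : ℕ
    Adj   : Fin n → Fin n → Set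
    sym   : ∀ {x y} → Adj x y → Adj y x
    irrefl : ∀ {x} → ¬ Adj x x

open Graph public

module _ (G : Graph) where
  V : Set
  V = Fin (n G)

  data Walk : V → V → ℕ → Set where
    here : ∀ {x} → Walk x x 0
    step : ∀ {x z y k} → Adj G x z → Walk z y k → Walk x y (suc k)

  Connected : Set
  Connected = ∀ (x y : V) → ∃ λ k → Walk x y k

  data Chain : List V → Set where
    single : ∀ {x} → Chain (x ∷ [])
    cons   : ∀ {x y ys} → Adj G x y → Chain (y ∷ ys) → Chain (x ∷ y ∷ ys)

  IsPath : List V → Set
  IsPath P = Chain P × Unique P

  -- P ∈ ℒ(G): a path with the maximum number l(G)+1 of vertices
  InL : List V → Set
  InL P = IsPath P × (∀ Q → IsPath Q → length Q ≤ length P)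

  -- two vertex sequences describe the same path (subgraph) iff equal or reversed
  SamePath : List V → List V → Set
  SamePath P Q = P ≡ Q ⊎ P ≡ reverse Q

  DistTo : V → List V → ℕ → Set
  DistTo v U k = (∃ λ u → u ∈ U × Walk v u k)
               × (∀ u k' → u ∈ U → Walk v u k' → k ≤ k')

  IsF : List V → List V → List V → ℕ → Set
  IsF P₁ P₂ P₃ m =
      (Σ V λ v → Σ ℕ λ k₁ → Σ ℕ λ k₂ → Σ ℕ λ k₃ →
         DistTo v P₁ k₁ × DistTo v P₂ k₂ × DistTo v P₃ k₃ × k₁ + k₂ + k₃ ≡ m)
    × (∀ v k₁ k₂ k₃ → DistTo v P₁ k₁ → DistTo v P₂ k₂ → DistTo v P₃ k₃ →
         m ≤ k₁ + k₂ + k₃)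

  open DecMem (_≟_ {n G}) using (_∈?_)

  -- |X_𝒫(P)| where 𝒫 ∖ {P} = {P₁, P₂}: vertices of P lying on neither P₁ nor P₂
  Xsize : List V → List V → List V → ℕ
  Xsize P P₁ P₂ = length (filter (λ v → ¬? (v ∈? P₁ ⊎-dec v ∈? P₂)) P)

  segments : List V → List (List V)
  segments []       = []
  segments (x ∷ xs) = map (x ∷_) (inits xs) ++ segments xs

  lastOf : V → List V → V
  lastOf a []       = a
  lastOf a (x ∷ xs) = lastOf x xs

  MeetsOnlyAt : List V → List V → V → Set
  MeetsOnlyAt X S a = a ∈ X × All (λ v → v ∈ X → v ≡ a) S

  meetsOnlyAt? : ∀ X S a → Dec (MeetsOnlyAt X S a)
  meetsOnlyAt? X S a = (a ∈? X) ×-dec all? (λ v → (v ∈? X) →-dec (v ≟ a)) S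

  IsXYPath : List V → List V → List V → Set
  IsXYPath X Y []       = ⊥
  IsXYPath X Y (a ∷ s)  =
      (MeetsOnlyAt X (a ∷ s) a × MeetsOnlyAt Y (a ∷ s) (lastOf a s))
    ⊎ (MeetsOnlyAt X (a ∷ s) (lastOf a s) × MeetsOnlyAt Y (a ∷ s) a)

  isXYPath? : ∀ X Y S → Dec (IsXYPath X Y S)
  isXYPath? X Y []      = no (λ ())
  isXYPath? X Y (a ∷ s) =
      (meetsOnlyAt? X (a ∷ s) a ×-dec meetsOnlyAt? Y (a ∷ s) (lastOf a s))
    ⊎-dec (meetsOnlyAt? X (a ∷ s) (lastOf a s) ×-dec meetsOnlyAt? Y (a ∷ s) a)

  tval : List V → List V → List V → ℕ
  tval P P₁ P₂ = length (filter (isXYPath? P₁ P₂) (segments P))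

module Submission where

-- Fix one of the three paths, P, and call the vertices of the other two
-- paths X and Y "marked".  An X–Y path a ∷ t that is a subpath of P has at
-- least f = f(G,𝒫) edges: its first vertex lies on P and on one of X, Y and
-- reaches the other one along the subpath, so it witnesses f ≤ 0 + 0 + |t|.
-- All its inner vertices are unmarked, i.e. lie in X_𝒫(P), and the inner
-- vertices of different X–Y subpaths are disjoint, which gives
-- t_𝒫(P) · (f - 1) ≤ |X_𝒫(P)|.
--
-- Distances exist only classically (adjacency
-- is not decidable), but the conclusion f ≤ e₁ + e₂ + e₃ is decidable, which
-- yields the bound f-≤ on f and hence the separation of X and Y on P.  The
-- counting is a purely combinatorial statement about a duplicate-free vertex
-- sequence Q (xy-count): scanning Q from its end we keep the invariant
-- (#X–Y subpaths)·k + (#unmarked vertices before the first marked one)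
-- ≤ #unmarked vertices, where k is a strict lower bound on the number of edges
-- of the X–Y subpaths.  The theorem applies this to each of the three paths,
-- using that f does not depend on the order of the paths.

open import Defs hiding (sym)
open import Data.Nat using (ℕ; zero; suc; _+_; _*_; _∸_; _≤_; _<_; z≤n; s≤s; _≤?_)
open import Data.Nat.Properties
  using (≤-trans; ≤-reflexive; +-mono-≤; +-monoˡ-≤; +-comm; +-assoc; +-suc; +-identityʳ;
         *-zeroʳ; *-distribʳ-+; m≤m+n; ≮⇒≥; n≮0; m<1+n⇒m≤n; module ≤-Reasoning)
open import Data.Nat.Induction using (<-rec)
open import Data.Fin.Properties using (_≟_)
open import Data.List using (List; []; _∷_; _++_; _∷ʳ_; length; map; inits; filter)
open import Data.List.Properties
  using (filter-accept; filter-reject; filter-none; filter-++; length-++; map-∘; map-cong;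
         ++-assoc; ++-identityʳ)
open import Data.List.Relation.Unary.All using (All; []; _∷_)
import Data.List.Relation.Unary.All as All
open import Data.List.Relation.Unary.All.Properties using (++⁺; map⁺)
open import Data.List.Relation.Unary.AllPairs using ([]; _∷_)
open import Data.List.Relation.Unary.Unique.Propositional using (Unique)
open import Data.List.Relation.Unary.Any using (here; there)
open import Data.List.Membership.Propositional using (_∈_)
open import Data.List.Membership.Propositional.Properties using (∈-++⁺ˡ; ∈-++⁺ʳ)
import Data.List.Membership.DecPropositional as DecMem
open import Data.Product using (∃; _×_; _,_)
open import Data.Sum using (_⊎_; inj₁; inj₂)
open import Relation.Nullary using (¬_; Dec; yes; no; ¬?)
open import Relation.Nullary.Decidable using (_⊎-dec_; decidable-stable; ¬¬-excluded-middle)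
open import Relation.Nullary.Negation using (¬¬-map)
open import Relation.Binary.PropositionalEquality
  using (_≡_; _≢_; refl; sym; trans; cong; cong₂; subst; module ≡-Reasoning)

-- An inhabited predicate on ℕ has, up to double negation, a least inhabitant.
-- This is how the distance d(v,U) is obtained from a walk from v to U.
¬¬-least : (P : ℕ → Set) → ∀ e → P e → ¬ ¬ (∃ λ k → P k × (∀ j → P j → k ≤ j))
¬¬-least P = <-rec (λ e → P e → ¬ ¬ Least) descend
  where
  Least : Set
  Least = ∃ λ k → P k × (∀ j → P j → k ≤ j)

  descend : ∀ e → (∀ {j} → j < e → P j → ¬ ¬ Least) → P e → ¬ ¬ Least
  descend e below pe noLeast = ¬¬-excluded-middle {A = ∃ λ j → j < e × P j} λ where
    (yes (j , j<e , pj)) → below j<e pj noLeast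
    (no nothingBelow)    → noLeast (e , pe , λ j pj → ≮⇒≥ λ j<e → nothingBelow (j , j<e , pj))

module _ (G : Graph) where
  open DecMem (_≟_ {n G}) using (_∈?_)

  WalkTo : V G → List (V G) → ℕ → Set
  WalkTo v U k = ∃ λ u → u ∈ U × Walk G v u k

  ¬¬-distance : ∀ {v U e} → WalkTo v U e → ¬ ¬ (∃ λ k → DistTo G v U k × k ≤ e)
  ¬¬-distance {v} {U} {e} walk = ¬¬-map toDistance (¬¬-least (WalkTo v U) e walk)
    where
    toDistance : (∃ λ k → WalkTo v U k × (∀ j → WalkTo v U j → k ≤ j)) →
                 ∃ λ k → DistTo G v U k × k ≤ e
    toDistance (k , walkₖ , least) =
      k , (walkₖ , λ u j u∈U w → least j (u , u∈U , w)) , least e walk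

  -- f(G,{P₁,P₂,P₃}) is at most the total length of three walks from one vertex
  -- to the three paths; the conclusion is decidable, so the classical
  -- existence of the distances suffices.
  f-≤ : ∀ {P₁ P₂ P₃ m v e₁ e₂ e₃} → IsF G P₁ P₂ P₃ m →
        WalkTo v P₁ e₁ → WalkTo v P₂ e₂ → WalkTo v P₃ e₃ → m ≤ e₁ + e₂ + e₃
  f-≤ {m = m} {v} {e₁} {e₂} {e₃} (_ , minimal) w₁ w₂ w₃ =
    decidable-stable (m ≤? e₁ + e₂ + e₃) λ m≰ →
      ¬¬-distance w₁ λ (k₁ , d₁ , k₁≤e₁) →
      ¬¬-distance w₂ λ (k₂ , d₂ , k₂≤e₂) →
      ¬¬-distance w₃ λ (k₃ , d₃ , k₃≤e₃) →
      m≰ (≤-trans (minimal v k₁ k₂ k₃ d₁ d₂ d₃) (+-mono-≤ (+-mono-≤ k₁≤e₁ k₂≤e₂) k₃≤e₃))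

  IsF-swap₁₂ : ∀ {P₁ P₂ P₃ m} → IsF G P₁ P₂ P₃ m → IsF G P₂ P₁ P₃ m
  IsF-swap₁₂ {m = m} ((v , k₁ , k₂ , k₃ , d₁ , d₂ , d₃ , total) , minimal) =
      (v , k₂ , k₁ , k₃ , d₂ , d₁ , d₃ , trans (swap k₂ k₁ k₃) total)
    , λ v k₂ k₁ k₃ d₂ d₁ d₃ → subst (m ≤_) (swap k₁ k₂ k₃) (minimal v k₁ k₂ k₃ d₁ d₂ d₃)
    where
    swap : ∀ a b c → a + b + c ≡ b + a + c
    swap a b c = cong (_+ c) (+-comm a b)

  IsF-swap₂₃ : ∀ {P₁ P₂ P₃ m} → IsF G P₁ P₂ P₃ m → IsF G P₁ P₃ P₂ m
  IsF-swap₂₃ {m = m} ((v , k₁ , k₂ , k₃ , d₁ , d₂ , d₃ , total) , minimal) =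
      (v , k₁ , k₃ , k₂ , d₁ , d₃ , d₂ , trans (swap k₁ k₃ k₂) total)
    , λ v k₁ k₃ k₂ d₁ d₃ d₂ → subst (m ≤_) (swap k₁ k₂ k₃) (minimal v k₁ k₂ k₃ d₁ d₂ d₃)
    where
    swap : ∀ a b c → a + b + c ≡ a + c + b
    swap a b c = trans (+-assoc a b c) (trans (cong (a +_) (+-comm b c)) (sym (+-assoc a c b)))

  Separated : List (V G) → List (V G) → List (V G) → ℕ → Set
  Separated P X Y m = ∀ {a u s} → a ∈ P → a ∈ X → u ∈ Y → Walk G a u s → m ≤ s

  separated : ∀ {P X Y m} → IsF G P X Y m → Separated P X Y m
  separated F a∈P a∈X u∈Y walk = f-≤ F (_ , a∈P , here) (_ , a∈X , here) (_ , u∈Y , walk)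

  lastOf-∈ : ∀ a s → lastOf G a s ∈ a ∷ s
  lastOf-∈ a []      = here refl
  lastOf-∈ a (b ∷ s) = there (lastOf-∈ b s)

  lastOf-++ : ∀ a w b r → lastOf G a (w ++ b ∷ r) ≡ lastOf G b r
  lastOf-++ a []      b r = refl
  lastOf-++ a (c ∷ w) b r = lastOf-++ c w b r

  chain-walk : ∀ a t → Chain G (a ∷ t) → Walk G a (lastOf G a t) (length t)
  chain-walk a []      single        = here
  chain-walk a (b ∷ t) (cons adj ch) = step adj (chain-walk b t ch)

  chain-infix : ∀ p a t u → Chain G (p ++ a ∷ t ++ u) → Chain G (a ∷ t)
  chain-infix []          a []      u _             = single
  chain-infix []          a (b ∷ t) u (cons adj ch) = cons adj (chain-infix [] b t u ch)
  chain-infix (x ∷ [])    a t       u (cons _ ch)   = chain-infix [] a t u ch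
  chain-infix (x ∷ y ∷ p) a t       u (cons _ ch)   = chain-infix (y ∷ p) a t u ch

  long-subpaths : ∀ {P X Y m} → Chain G P → Separated P X Y m → Separated P Y X m →
                  ∀ p a t u → p ++ a ∷ t ++ u ≡ P → IsXYPath G X Y (a ∷ t) → m ≤ length t
  long-subpaths ch sepXY sepYX p a t u refl (inj₁ ((a∈X , _) , (last∈Y , _))) =
    sepXY (∈-++⁺ʳ p (here refl)) a∈X last∈Y (chain-walk a t (chain-infix p a t u ch))
  long-subpaths ch sepXY sepYX p a t u refl (inj₂ ((last∈X , _) , (a∈Y , _))) =
    sepYX (∈-++⁺ʳ p (here refl)) a∈Y last∈X (chain-walk a t (chain-infix p a t u ch))

  module Counting (X Y : List (V G)) where
    Marked : V G → Set
    Marked v = v ∈ X ⊎ v ∈ Y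

    marked? : ∀ v → Dec (Marked v)
    marked? v = v ∈? X ⊎-dec v ∈? Y

    Unmarked : V G → Set
    Unmarked v = ¬ Marked v

    unmarked? : ∀ v → Dec (Unmarked v)
    unmarked? v = ¬? (marked? v)

    IsXY : List (V G) → Set
    IsXY = IsXYPath G X Y

    #XY : List (List (V G)) → ℕ
    #XY L = length (filter (isXYPath? G X Y) L)

    #XY-++ : ∀ L₁ L₂ → #XY (L₁ ++ L₂) ≡ #XY L₁ + #XY L₂
    #XY-++ L₁ L₂ =
      trans (cong length (filter-++ (isXYPath? G X Y) L₁ L₂)) (length-++ (filter _ L₁))

    #XY-reject : ∀ {S L} → ¬ IsXY S → #XY (S ∷ L) ≡ #XY L
    #XY-reject ¬xy = cong length (filter-reject (isXYPath? G X Y) ¬xy)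

    #XY-none : ∀ {L} → All (λ S → ¬ IsXY S) L → #XY L ≡ 0
    #XY-none none = cong length (filter-none (isXYPath? G X Y) none)

    xy-head-marked : ∀ {a s} → IsXY (a ∷ s) → Marked a
    xy-head-marked (inj₁ ((a∈X , _) , _)) = inj₁ a∈X
    xy-head-marked (inj₂ (_ , (a∈Y , _))) = inj₂ a∈Y

    xy-last-marked : ∀ {a s} → IsXY (a ∷ s) → Marked (lastOf G a s)
    xy-last-marked (inj₁ (_ , (last∈Y , _))) = inj₂ last∈Y
    xy-last-marked (inj₂ ((last∈X , _) , _)) = inj₁ last∈X

    xy-inner-unmarked : ∀ {a s x} → IsXY (a ∷ s) → x ∈ a ∷ s → Marked x →
                        x ≡ a ⊎ x ≡ lastOf G a s
    xy-inner-unmarked (inj₁ ((_ , onlyX) , _)) x∈ (inj₁ x∈X) = inj₁ (All.lookup onlyX x∈ x∈X)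
    xy-inner-unmarked (inj₁ (_ , (_ , onlyY))) x∈ (inj₂ x∈Y) = inj₂ (All.lookup onlyY x∈ x∈Y)
    xy-inner-unmarked (inj₂ ((_ , onlyX) , _)) x∈ (inj₁ x∈X) = inj₂ (All.lookup onlyX x∈ x∈X)
    xy-inner-unmarked (inj₂ (_ , (_ , onlyY))) x∈ (inj₂ x∈Y) = inj₁ (All.lookup onlyY x∈ x∈Y)

    leadingUnmarked : List (V G) → ℕ
    leadingUnmarked []       = 0
    leadingUnmarked (x ∷ xs) with marked? x
    ... | yes _ = 0
    ... | no _  = suc (leadingUnmarked xs)

    LongSegments : ℕ → List (V G) → Set
    LongSegments k Q = ∀ p a t u → p ++ a ∷ t ++ u ≡ Q → IsXY (a ∷ t) → k < length t

    -- The X–Y subpaths starting at a vertex a followed by ρ (with a ∉ ρ, ρ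
    -- duplicate-free): at most one of them is an X–Y path, the one ending at
    -- the first marked vertex of ρ, so it spans the leading unmarked vertices
    -- of ρ.
    module StartingAt (k : ℕ) (a : V G) (ρ : List (V G))
                      (long : ∀ t u → t ++ u ≡ ρ → IsXY (a ∷ t) → k < length t) where

      extending : List (V G) → List (V G) → List (List (V G))
      extending w []      = (a ∷ w) ∷ []
      extending w (x ∷ r) = (a ∷ w) ∷ extending (w ∷ʳ x) r

      extending-inits : ∀ w r → map (λ t → a ∷ w ++ t) (inits r) ≡ extending w r
      extending-inits w []      = cong (λ s → (a ∷ s) ∷ []) (++-identityʳ w)
      extending-inits w (x ∷ r) = cong₂ _∷_ (cong (a ∷_) (++-identityʳ w)) (begin
        map (λ t → a ∷ w ++ t) (map (x ∷_) (inits r))  ≡⟨ sym (map-∘ (inits r)) ⟩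
        map (λ t → a ∷ w ++ x ∷ t) (inits r)           ≡⟨ map-cong regroup (inits r) ⟩
        map (λ t → a ∷ (w ∷ʳ x) ++ t) (inits r)        ≡⟨ extending-inits (w ∷ʳ x) r ⟩
        extending (w ∷ʳ x) r                           ∎)
        where
        open ≡-Reasoning
        regroup : ∀ t → a ∷ w ++ x ∷ t ≡ a ∷ (w ∷ʳ x) ++ t
        regroup t = cong (a ∷_) (sym (++-assoc w (x ∷ []) t))

      -- a ∷ s with s unmarked is not an X–Y path: its last vertex is unmarked,
      -- or it is the single vertex a, which has no more than k edges
      ¬xy-unmarked : ∀ s → All Unmarked s → ¬ IsXY (a ∷ s)
      ¬xy-unmarked []      _        xy = n≮0 (long [] ρ refl xy)
      ¬xy-unmarked (x ∷ s) unmarked xy = All.lookup unmarked (lastOf-∈ x s) (xy-last-marked xy)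

      ¬xy-blocked : ∀ {x} v → Marked x → x ≢ a → x ∈ v → x ≢ lastOf G a v → ¬ IsXY (a ∷ v)
      ¬xy-blocked v mx x≢a x∈v x≢last xy with xy-inner-unmarked xy (there x∈v) mx
      ... | inj₁ x≡a    = x≢a x≡a
      ... | inj₂ x≡last = x≢last x≡last

      blocked : ∀ {x} v r → Marked x → x ≢ a → x ∈ v → x ≢ lastOf G a v →
                All (x ≢_) r → #XY (extending v r) ≡ 0
      blocked v [] mx x≢a x∈v x≢last _ = #XY-reject (¬xy-blocked v mx x≢a x∈v x≢last)
      blocked {x} v (y ∷ ys) mx x≢a x∈v x≢last (x≢y ∷ x∉ys) =
        trans (#XY-reject (¬xy-blocked v mx x≢a x∈v x≢last))
              (blocked (v ∷ʳ y) ys mx x≢a (∈-++⁺ˡ x∈v) x≢lastʹ x∉ys)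
        where
        x≢lastʹ : x ≢ lastOf G a (v ∷ʳ y)
        x≢lastʹ = subst (x ≢_) (sym (lastOf-++ a v y [])) x≢y

      #XY-single : ∀ S {c} → (IsXY S → k ≤ c) → #XY (S ∷ []) * k ≤ c
      #XY-single S bound with isXYPath? G X Y S
      ... | yes xy = ≤-trans (≤-reflexive (+-identityʳ k)) (bound xy)
      ... | no _   = z≤n

      after-marked : ∀ {x} w ys → Marked x → x ≢ a → All (x ≢_) ys →
                     #XY (extending (w ∷ʳ x) ys) ≡ #XY ((a ∷ w ∷ʳ x) ∷ [])
      after-marked w []       _  _   _            = refl
      after-marked {x} w (y ∷ ys) mx x≢a (x≢y ∷ x∉ys) = begin
        #XY (extending (w ∷ʳ x) (y ∷ ys))
          ≡⟨ #XY-++ ((a ∷ w ∷ʳ x) ∷ []) (extending (w ∷ʳ x ∷ʳ y) ys) ⟩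
        #XY ((a ∷ w ∷ʳ x) ∷ []) + #XY (extending (w ∷ʳ x ∷ʳ y) ys)
          ≡⟨ cong (#XY ((a ∷ w ∷ʳ x) ∷ []) +_)
                  (blocked (w ∷ʳ x ∷ʳ y) ys mx x≢a x∈ x≢y-last x∉ys) ⟩
        #XY ((a ∷ w ∷ʳ x) ∷ []) + 0
          ≡⟨ +-identityʳ _ ⟩
        #XY ((a ∷ w ∷ʳ x) ∷ []) ∎
        where
        open ≡-Reasoning
        x∈ : x ∈ w ∷ʳ x ∷ʳ y
        x∈ = ∈-++⁺ˡ (∈-++⁺ʳ w (here refl))
        x≢y-last : x ≢ lastOf G a (w ∷ʳ x ∷ʳ y)
        x≢y-last = subst (x ≢_) (sym (lastOf-++ a (w ∷ʳ x) y [])) x≢y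

      candidate-long : ∀ w x xs → (w ∷ʳ x) ++ xs ≡ ρ → IsXY (a ∷ w ∷ʳ x) → k ≤ length w
      candidate-long w x xs prefix xy =
        m<1+n⇒m≤n (subst (k <_) length-w∷ʳx (long (w ∷ʳ x) xs prefix xy))
        where
        length-w∷ʳx : length (w ∷ʳ x) ≡ suc (length w)
        length-w∷ʳx = trans (length-++ w) (+-comm (length w) 1)

      start-bound : ∀ w r → w ++ r ≡ ρ → All Unmarked w → All (a ≢_) r → Unique r →
                    #XY (extending w r) * k ≤ length w + leadingUnmarked r
      start-bound w [] _ unmarked _ _ =
        ≤-trans (≤-reflexive (cong (_* k) (#XY-reject (¬xy-unmarked w unmarked)))) z≤n
      start-bound w (x ∷ xs) w++r≡ρ unmarked (a≢x ∷ a∉xs) (x∉xs ∷ unique) with marked? x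
      ... | no ¬mx = begin
        #XY (extending w (x ∷ xs)) * k          ≡⟨ cong (_* k) (#XY-reject (¬xy-unmarked w unmarked)) ⟩
        #XY (extending (w ∷ʳ x) xs) * k         ≤⟨ start-bound (w ∷ʳ x) xs
                                                     (trans (++-assoc w (x ∷ []) xs) w++r≡ρ)
                                                     (++⁺ unmarked (¬mx ∷ [])) a∉xs unique ⟩
        length (w ∷ʳ x) + leadingUnmarked xs    ≡⟨ cong (_+ leadingUnmarked xs) (length-++ w) ⟩
        length w + 1 + leadingUnmarked xs       ≡⟨ +-assoc (length w) 1 (leadingUnmarked xs) ⟩
        length w + suc (leadingUnmarked xs)     ∎
        where open ≤-Reasoning
      ... | yes mx = begin
        #XY (extending w (x ∷ xs)) * k          ≡⟨ cong (_* k) (#XY-reject (¬xy-unmarked w unmarked)) ⟩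
        #XY (extending (w ∷ʳ x) xs) * k         ≡⟨ cong (_* k) (after-marked w xs mx x≢a x∉xs) ⟩
        #XY ((a ∷ w ∷ʳ x) ∷ []) * k             ≤⟨ #XY-single (a ∷ w ∷ʳ x) (candidate-long w x xs
                                                     (trans (++-assoc w (x ∷ []) xs) w++r≡ρ)) ⟩
        length w                                ≡⟨ +-identityʳ (length w) ⟨
        length w + 0                            ∎
        where
        open ≤-Reasoning
        x≢a : x ≢ a
        x≢a x≡a = a≢x (sym x≡a)

      starting-bound : All (a ≢_) ρ → Unique ρ →
                       #XY (map (a ∷_) (inits ρ)) * k ≤ leadingUnmarked ρ
      starting-bound a∉ρ unique =
        subst (λ L → #XY L * k ≤ leadingUnmarked ρ) (sym (extending-inits [] ρ))
              (start-bound [] ρ refl [] a∉ρ unique)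

    long-tail : ∀ {k a r} → LongSegments k (a ∷ r) → LongSegments k r
    long-tail {a = a} long p b t u eq = long (a ∷ p) b t u (cong (a ∷_) eq)

    long-head : ∀ {k a r} → LongSegments k (a ∷ r) →
                ∀ t u → t ++ u ≡ r → IsXY (a ∷ t) → k < length t
    long-head {a = a} long t u eq = long [] a t u (cong (a ∷_) eq)

    count-invariant : ∀ k Q → Unique Q → LongSegments k Q →
                      #XY (segments G Q) * k + leadingUnmarked Q ≤ Xsize G Q X Y
    count-invariant k []      _              _    = z≤n
    count-invariant k (a ∷ r) (a∉r ∷ unique) long with marked? a
    ... | no ¬ma = begin
      #XY (segments G (a ∷ r)) * k + suc (leadingUnmarked r)
        ≡⟨ cong (λ c → c * k + suc (leadingUnmarked r)) none-from-a ⟩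
      #XY (segments G r) * k + suc (leadingUnmarked r)
        ≡⟨ +-suc _ _ ⟩
      suc (#XY (segments G r) * k + leadingUnmarked r)
        ≤⟨ s≤s (count-invariant k r unique (long-tail long)) ⟩
      suc (Xsize G r X Y)
        ≡⟨ cong length (filter-accept unmarked? ¬ma) ⟨
      Xsize G (a ∷ r) X Y ∎
      where
      open ≤-Reasoning
      none-from-a : #XY (segments G (a ∷ r)) ≡ #XY (segments G r)
      none-from-a = trans (#XY-++ (map (a ∷_) (inits r)) (segments G r))
        (cong (_+ #XY (segments G r))
          (#XY-none (map⁺ (All.universal (λ t xy → ¬ma (xy-head-marked xy)) (inits r)))))
    ... | yes ma = begin
      #XY (segments G (a ∷ r)) * k + 0
        ≡⟨ +-identityʳ _ ⟩
      #XY (segments G (a ∷ r)) * k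
        ≡⟨ cong (_* k) (#XY-++ (map (a ∷_) (inits r)) (segments G r)) ⟩
      (#from-a + #rest) * k
        ≡⟨ *-distribʳ-+ k #from-a #rest ⟩
      #from-a * k + #rest * k
        ≤⟨ +-monoˡ-≤ (#rest * k) (StartingAt.starting-bound k a r (long-head long) a∉r unique) ⟩
      leadingUnmarked r + #rest * k
        ≡⟨ +-comm (leadingUnmarked r) _ ⟩
      #rest * k + leadingUnmarked r
        ≤⟨ count-invariant k r unique (long-tail long) ⟩
      Xsize G r X Y
        ≡⟨ cong length (filter-reject unmarked? (λ ¬ma → ¬ma ma)) ⟨
      Xsize G (a ∷ r) X Y ∎
      where
      open ≤-Reasoning
      #from-a #rest : ℕ
      #from-a = #XY (map (a ∷_) (inits r))
      #rest   = #XY (segments G r)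

    xy-count : ∀ k Q → Unique Q → LongSegments k Q → tval G Q X Y * k ≤ Xsize G Q X Y
    xy-count k Q unique long = ≤-trans (m≤m+n _ _) (count-invariant k Q unique long)

  path-bound : ∀ {P X Y m} → IsPath G P → IsF G P X Y m →
               tval G P X Y * (m ∸ 1) ≤ Xsize G P X Y
  path-bound {P} {X} {Y} {zero} _ _ =
    ≤-trans (≤-reflexive (*-zeroʳ (tval G P X Y))) z≤n
  path-bound {P} {X} {Y} {suc k} (chain , unique) F =
    Counting.xy-count X Y k P unique (long-subpaths chain (separated F) (separated (IsF-swap₂₃ F)))

lemma2p2 : (G : Graph) → Connected G →
    (P₁ P₂ P₃ : List (V G)) →
    InL G P₁ → InL G P₂ → InL G P₃ →
    ¬ SamePath G P₁ P₂ → ¬ SamePath G P₁ P₃ → ¬ SamePath G P₂ P₃ →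
    (m : ℕ) → IsF G P₁ P₂ P₃ m →
      (tval G P₁ P₂ P₃ * (m ∸ 1) ≤ Xsize G P₁ P₂ P₃)
    × (tval G P₂ P₁ P₃ * (m ∸ 1) ≤ Xsize G P₂ P₁ P₃)
    × (tval G P₃ P₁ P₂ * (m ∸ 1) ≤ Xsize G P₃ P₁ P₂)
lemma2p2 G _ P₁ P₂ P₃ (path₁ , _) (path₂ , _) (path₃ , _) _ _ _ m F =
    path-bound G path₁ F
  , path-bound G path₂ (IsF-swap₁₂ G F)
  , path-bound G path₃ (IsF-swap₁₂ G (IsF-swap₂₃ G F))
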